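{- Let $k$ be a positive integer. If $G$ is a graph, then for any edge $e\in E(G)$, $$L_{k,t}(G)\leq L_{k,t}(G-e)\leq L_{k,t}(G)+2.$$ Furthermore, both bounds are sharp, i.e., each is attained with equality for some graph $G$ and edge $e$.
   Context: All graphs are finite and simple; $G-e$ is the graph obtained from $G$ by deleting the edge $e$. $N(v)$ denotes the open neighborhood of $v$. A set $B\subseteq V(G)$ is a $k$-total limited packing set if $|B\cap N(v)|\leq k$ for every $v\in V(G)$; $L_{k,t}(G)$ is the maximum cardinality of such a set. -}

module Defs where

open import Data.Nat using (ℕ; _≤_)
open import Data.Bool using (Bool; true; false; _∧_; _∨_; not)
open import Data.Bool.Properties using (∨-comm; ∧-zeroˡ)
open import Data.Fin using (Fin)
open import Data.Fin.Properties using (_≟_)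
open import Data.Fin.Subset using (Subset; _∩_; ∣_∣)
open import Data.Vec using (tabulate)
open import Data.Product using (Σ; _×_)
open import Relation.Nullary.Decidable using (⌊_⌋)
open import Relation.Binary.PropositionalEquality using (_≡_; refl)

record Graph (n : ℕ) : Set where
  field
    adj    : Fin n → Fin n → Bool
    symm   : ∀ x y → adj x y ≡ adj y x
    irrefl : ∀ x → adj x x ≡ false
open Graph public

N : ∀ {n} → Graph n → Fin n → Subset n
N G v = tabulate (adj G v)

sameEdge : ∀ {n} → Fin n → Fin n → Fin n → Fin n → Bool
sameEdge u v x y = (⌊ x ≟ u ⌋ ∧ ⌊ y ≟ v ⌋) ∨ (⌊ x ≟ v ⌋ ∧ ⌊ y ≟ u ⌋)

private
  boolLemma : ∀ a b c d → (a ∧ b) ∨ (c ∧ d) ≡ (d ∧ c) ∨ (b ∧ a)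
  boolLemma true  true  true  true  = refl
  boolLemma true  true  true  false = refl
  boolLemma true  true  false true  = refl
  boolLemma true  true  false false = refl
  boolLemma true  false true  true  = refl
  boolLemma true  false true  false = refl
  boolLemma true  false false true  = refl
  boolLemma true  false false false = refl
  boolLemma false true  true  true  = refl
  boolLemma false true  true  false = refl
  boolLemma false true  false true  = refl
  boolLemma false true  false false = refl
  boolLemma false false true  true  = refl
  boolLemma false false true  false = refl
  boolLemma false false false true  = refl
  boolLemma false false false false = refl

  sameEdge-sym : ∀ {n} (u v x y : Fin n) → sameEdge u v x y ≡ sameEdge u v y x
  sameEdge-sym u v x y = boolLemma ⌊ x ≟ u ⌋ ⌊ y ≟ v ⌋ ⌊ x ≟ v ⌋ ⌊ y ≟ u ⌋

deleteEdge : ∀ {n} → Graph n → Fin n → Fin n → Graph n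
adj    (deleteEdge G u v) x y = adj G x y ∧ not (sameEdge u v x y)
symm   (deleteEdge G u v) x y rewrite symm G x y | sameEdge-sym u v x y = refl
irrefl (deleteEdge G u v) x rewrite irrefl G x = refl

IsTotalLimitedPacking : ∀ {n} → Graph n → ℕ → Subset n → Set
IsTotalLimitedPacking G k B = ∀ v → ∣ B ∩ N G v ∣ ≤ k

IsLkt : ∀ {n} → Graph n → ℕ → ℕ → Set
IsLkt G k m =
  Σ (Subset _) (λ B → IsTotalLimitedPacking G k B × ∣ B ∣ ≡ m)
  × (∀ B → IsTotalLimitedPacking G k B → ∣ B ∣ ≤ m)

-- Every neighbourhood of G − uv lies inside the corresponding neighbourhood of G, so a
-- packing of G is a packing of G − uv.  Away from u and v the two graphs have the same
-- neighbourhoods, so deleting u and v from a packing of G − uv leaves a packing of G,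
-- at a cost of at most two vertices.
--
-- Sharpness.  If every degree is at most k, the whole vertex set is a packing; this
-- handles K₂ and K₂ − e.  In the double star with k leaves on each centre, every vertex
-- is adjacent to one of the two centres, so a packing meets at most 2k vertices, and the
-- 2k leaves attain this; deleting the central edge brings the maximum degree down to k,
-- and then all 2k + 2 vertices form a packing.

module Submission where

open import Defs
open import Data.Nat using (ℕ; zero; suc; _≤_; _<_; _+_; _∸_; z≤n; s≤s; s≤s⁻¹)
open import Data.Nat.Properties
  using ( module ≤-Reasoning; ≤-trans; ≤-reflexive; <-≤-trans
        ; +-suc; +-comm; +-mono-≤; +-monoʳ-≤; n≤1+n; m+n∸m≡n)
open import Data.Bool using (true; false; not; _∨_)
open import Data.Bool.Properties using (∧-zeroʳ; ∧-identityʳ; ∧-conicalˡ)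
open import Data.Fin using (Fin; zero; suc)
open import Data.Fin.Properties using (_≟_)
open import Data.Fin.Subset
  using (Subset; inside; outside; _∈_; _∉_; _⊆_; _∩_; _∪_; _─_; _-_; ⁅_⁆; ∁; ⊤; ⊥; ∣_∣)
open import Data.Fin.Subset.Properties
  using ( p⊆q⇒∣p∣≤∣q∣; p⊂q⇒∣p∣<∣q∣; ∣p∣≤n; ∣⊤∣≡n; ∣⊥∣≡0; ∣∁p∣≡n∸∣p∣; ∣⁅x⁆∣≡1; ∣p∩q∣≤∣q∣
        ; _∈?_; x∈p∩q⁺; x∈p∩q⁻; x∈p∪q⁺; x∈p∧x∉q⇒x∈p─q; p─q⊆p; p─⊥≡p; x∉⁅y⁆⇒x≢y)
open import Data.Vec using (_∷_; []; lookup; map; here; there)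
open import Data.Vec.Properties
  using (lookup∘tabulate; tabulate∘lookup; tabulate-∘; tabulate-cong; lookup-replicate; lookup⇒[]=; []=⇒lookup)
open import Data.Product using (Σ; _×_; _,_)
open import Data.Sum using (_⊎_; inj₁; inj₂)
open import Function using (_∘_)
open import Relation.Nullary using (yes; no)
open import Relation.Nullary.Decidable using (⌊_⌋; dec-yes-recompute; dec-no)
open import Relation.Binary.PropositionalEquality using (_≡_; _≢_; refl; sym; trans; cong; cong₂; subst)

private
  variable
    n m k d : ℕ
    x : Fin n

∣p∪q∣≤∣p∣+∣q∣ : ∀ (p q : Subset n) → ∣ p ∪ q ∣ ≤ ∣ p ∣ + ∣ q ∣
∣p∪q∣≤∣p∣+∣q∣ []            []            = z≤n
∣p∪q∣≤∣p∣+∣q∣ (outside ∷ p) (outside ∷ q) = ∣p∪q∣≤∣p∣+∣q∣ p q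
∣p∪q∣≤∣p∣+∣q∣ (outside ∷ p) (inside  ∷ q) =
  ≤-trans (s≤s (∣p∪q∣≤∣p∣+∣q∣ p q)) (≤-reflexive (sym (+-suc ∣ p ∣ ∣ q ∣)))
∣p∪q∣≤∣p∣+∣q∣ (inside  ∷ p) (outside ∷ q) = s≤s (∣p∪q∣≤∣p∣+∣q∣ p q)
∣p∪q∣≤∣p∣+∣q∣ (inside  ∷ p) (inside  ∷ q) =
  s≤s (≤-trans (∣p∪q∣≤∣p∣+∣q∣ p q) (+-monoʳ-≤ ∣ p ∣ (n≤1+n ∣ q ∣)))

p⊆p─q∪q : ∀ (p q : Subset n) → p ⊆ (p ─ q) ∪ q
p⊆p─q∪q p q {x} x∈p with x ∈? q
... | yes x∈q = x∈p∪q⁺ (inj₂ x∈q)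
... | no  x∉q = x∈p∪q⁺ (inj₁ (x∈p∧x∉q⇒x∈p─q x∈p x∉q))

∣p∣≤∣p─q∣+∣q∣ : ∀ (p q : Subset n) → ∣ p ∣ ≤ ∣ p ─ q ∣ + ∣ q ∣
∣p∣≤∣p─q∣+∣q∣ p q = ≤-trans (p⊆q⇒∣p∣≤∣q∣ (p⊆p─q∪q p q)) (∣p∪q∣≤∣p∣+∣q∣ (p ─ q) q)

∣p∣≤1+∣p-x∣ : ∀ (p : Subset n) x → ∣ p ∣ ≤ suc ∣ p - x ∣
∣p∣≤1+∣p-x∣ p x = subst (∣ p ∣ ≤_) eq (∣p∣≤∣p─q∣+∣q∣ p ⁅ x ⁆)
  where
  eq : ∣ p - x ∣ + ∣ ⁅ x ⁆ ∣ ≡ suc ∣ p - x ∣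
  eq = trans (cong (∣ p - x ∣ +_) (∣⁅x⁆∣≡1 x)) (+-comm ∣ p - x ∣ 1)

x∈p─q⇒x∉q : ∀ (p q : Subset n) → x ∈ p ─ q → x ∉ q
x∈p─q⇒x∉q (_ ∷ p) (outside ∷ q) here        ()
x∈p─q⇒x∉q (_ ∷ p) (_       ∷ q) (there x∈) (there x∈q) = x∈p─q⇒x∉q p q x∈ x∈q

x∈p-y⇒x≢y : ∀ (p : Subset n) y → x ∈ p - y → x ≢ y
x∈p-y⇒x≢y p y = x∉⁅y⁆⇒x≢y ∘ x∈p─q⇒x∉q p ⁅ y ⁆

prefix : ∀ a {b} → Subset (a + b)
prefix zero    = ⊥
prefix (suc a) = inside ∷ prefix a

∣prefix∣≡ : ∀ a b → ∣ prefix a {b} ∣ ≡ a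
∣prefix∣≡ zero    b = ∣⊥∣≡0 b
∣prefix∣≡ (suc a) b = cong suc (∣prefix∣≡ a b)

∣∁prefix∣≡ : ∀ a b → ∣ ∁ (prefix a {b}) ∣ ≡ b
∣∁prefix∣≡ a b =
  trans (∣∁p∣≡n∸∣p∣ (prefix a)) (trans (cong (a + b ∸_) (∣prefix∣≡ a b)) (m+n∸m≡n a b))

adj⇒∈N : ∀ (G : Graph n) w {x} → adj G w x ≡ true → x ∈ N G w
adj⇒∈N G w {x} wx = lookup⇒[]= x (N G w) (trans (lookup∘tabulate (adj G w) x) wx)

∈N⇒adj : ∀ (G : Graph n) w {x} → x ∈ N G w → adj G w x ≡ true
∈N⇒adj G w {x} x∈N = trans (sym (lookup∘tabulate (adj G w) x)) ([]=⇒lookup x∈N)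

MaxDegree≤ : Graph n → ℕ → Set
MaxDegree≤ G d = ∀ w → ∣ N G w ∣ ≤ d

packing-⊆ : ∀ (G H : Graph n) B C → (∀ w → B ∩ N G w ⊆ C ∩ N H w) →
            IsTotalLimitedPacking H k C → IsTotalLimitedPacking G k B
packing-⊆ _ _ _ _ B⊆C packing w = ≤-trans (p⊆q⇒∣p∣≤∣q∣ (B⊆C w)) (packing w)

⊤-packing : ∀ (G : Graph n) → MaxDegree≤ G k → IsTotalLimitedPacking G k ⊤
⊤-packing G Δ w = ≤-trans (∣p∩q∣≤∣q∣ ⊤ (N G w)) (Δ w)

IsLkt-⊤ : ∀ (G : Graph n) → MaxDegree≤ G k → IsLkt G k n
IsLkt-⊤ {n = n} G Δ = (⊤ , ⊤-packing G Δ , ∣⊤∣≡n n) , λ B _ → ∣p∣≤n B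

dominatingPair⇒∣B∣≤k+k : ∀ (G : Graph n) u v B → (∀ x → x ∈ N G u ⊎ x ∈ N G v) →
                         IsTotalLimitedPacking G k B → ∣ B ∣ ≤ k + k
dominatingPair⇒∣B∣≤k+k {k = k} G u v B dominated packing = begin
  ∣ B ∣                               ≤⟨ p⊆q⇒∣p∣≤∣q∣ B⊆ ⟩
  ∣ (B ∩ N G u) ∪ (B ∩ N G v) ∣       ≤⟨ ∣p∪q∣≤∣p∣+∣q∣ (B ∩ N G u) (B ∩ N G v) ⟩
  ∣ B ∩ N G u ∣ + ∣ B ∩ N G v ∣       ≤⟨ +-mono-≤ (packing u) (packing v) ⟩
  k + k                               ∎
  where
  open ≤-Reasoning
  B⊆ : B ⊆ (B ∩ N G u) ∪ (B ∩ N G v)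
  B⊆ {x} x∈B with dominated x
  ... | inj₁ x∈Nu = x∈p∪q⁺ (inj₁ (x∈p∩q⁺ (x∈B , x∈Nu)))
  ... | inj₂ x∈Nv = x∈p∪q⁺ (inj₂ (x∈p∩q⁺ (x∈B , x∈Nv)))

sameEdge-self : ∀ (u v : Fin n) → sameEdge u v u v ≡ true
sameEdge-self u v rewrite dec-yes-recompute (u ≟ u) refl | dec-yes-recompute (v ≟ v) refl = refl

sameEdge-≢ : ∀ {u v w : Fin n} → x ≢ u → x ≢ v → sameEdge u v w x ≡ false
sameEdge-≢ {x = x} {u} {v} {w} x≢u x≢v rewrite dec-no (x ≟ u) x≢u | dec-no (x ≟ v) x≢v =
  cong₂ _∨_ (∧-zeroʳ ⌊ w ≟ u ⌋) (∧-zeroʳ ⌊ w ≟ v ⌋)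

module _ (G : Graph n) (u v : Fin n) where

  private
    G-uv : Graph n
    G-uv = deleteEdge G u v

  deleteEdge-removes : adj G-uv u v ≡ false
  deleteEdge-removes rewrite sameEdge-self u v = ∧-zeroʳ (adj G u v)

  deleteEdge-keeps : ∀ {w} → x ≢ u → x ≢ v → adj G-uv w x ≡ adj G w x
  deleteEdge-keeps {x = x} {w} x≢u x≢v rewrite sameEdge-≢ {w = w} x≢u x≢v = ∧-identityʳ (adj G w x)

  N-deleteEdge-⊆ : ∀ w → N G-uv w ⊆ N G w
  N-deleteEdge-⊆ w x∈N = adj⇒∈N G w (∧-conicalˡ _ _ (∈N⇒adj G-uv w x∈N))

  degree-deleteEdge-≤ : ∀ w → ∣ N G-uv w ∣ ≤ ∣ N G w ∣
  degree-deleteEdge-≤ w = p⊆q⇒∣p∣≤∣q∣ (N-deleteEdge-⊆ w)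

  degree-deleteEdge-< : ∀ w x → adj G w x ≡ true → adj G-uv w x ≡ false →
                        ∣ N G-uv w ∣ < ∣ N G w ∣
  degree-deleteEdge-< w x wx∈G wx∉G-uv =
    p⊂q⇒∣p∣<∣q∣ (N-deleteEdge-⊆ w , x , adj⇒∈N G w wx∈G , x∉N)
    where
    x∉N : x ∉ N G-uv w
    x∉N x∈N with () ← trans (sym (∈N⇒adj G-uv w x∈N)) wx∉G-uv

  degree-deleteEdge-<ˡ : adj G u v ≡ true → ∣ N G-uv u ∣ < ∣ N G u ∣
  degree-deleteEdge-<ˡ uv = degree-deleteEdge-< u v uv deleteEdge-removes

  degree-deleteEdge-<ʳ : adj G u v ≡ true → ∣ N G-uv v ∣ < ∣ N G v ∣
  degree-deleteEdge-<ʳ uv =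
    degree-deleteEdge-< v u (trans (symm G v u) uv) (trans (symm G-uv v u) deleteEdge-removes)

  MaxDegree≤-deleteEdge : MaxDegree≤ G d → MaxDegree≤ G-uv d
  MaxDegree≤-deleteEdge Δ w = ≤-trans (degree-deleteEdge-≤ w) (Δ w)

  packing-deleteEdge⁺ : ∀ B → IsTotalLimitedPacking G k B → IsTotalLimitedPacking G-uv k B
  packing-deleteEdge⁺ B = packing-⊆ G-uv G B B λ w x∈ →
    let x∈B , x∈N = x∈p∩q⁻ B (N G-uv w) x∈ in x∈p∩q⁺ (x∈B , N-deleteEdge-⊆ w x∈N)

  packing-deleteEdge⁻ : ∀ B → IsTotalLimitedPacking G-uv k B → IsTotalLimitedPacking G k (B - u - v)
  packing-deleteEdge⁻ B = packing-⊆ G G-uv (B - u - v) B λ w x∈ →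
    let x∈B-u-v , x∈N = x∈p∩q⁻ (B - u - v) (N G w) x∈
        x∈B-u          = p─q⊆p (B - u) ⁅ v ⁆ x∈B-u-v
        x≢u            = x∈p-y⇒x≢y B u x∈B-u
        x≢v            = x∈p-y⇒x≢y (B - u) v x∈B-u-v
    in x∈p∩q⁺ ( p─q⊆p B ⁅ u ⁆ x∈B-u
              , adj⇒∈N G-uv w (trans (deleteEdge-keeps x≢u x≢v) (∈N⇒adj G w x∈N)))

  IsLkt-deleteEdge-bounds : ∀ {m m′} → IsLkt G k m → IsLkt G-uv k m′ → m ≤ m′ × m′ ≤ m + 2
  IsLkt-deleteEdge-bounds ((B , packing , refl) , maximal) ((B′ , packing′ , refl) , maximal′) =
    maximal′ B (packing-deleteEdge⁺ B packing) , (begin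
      ∣ B′ ∣                 ≤⟨ ∣p∣≤1+∣p-x∣ B′ u ⟩
      suc ∣ B′ - u ∣         ≤⟨ s≤s (∣p∣≤1+∣p-x∣ (B′ - u) v) ⟩
      2 + ∣ B′ - u - v ∣     ≤⟨ s≤s (s≤s (maximal (B′ - u - v) (packing-deleteEdge⁻ B′ packing′))) ⟩
      2 + ∣ B ∣              ≡⟨ +-comm 2 ∣ B ∣ ⟩
      ∣ B ∣ + 2              ∎)
    where open ≤-Reasoning

pattern centreˡ = zero
pattern centreʳ = suc zero
pattern leaf i  = suc (suc i)

doubleStar : Subset m → Graph (2 + m)
adj (doubleStar L) centreˡ  centreˡ  = false
adj (doubleStar L) centreˡ  centreʳ  = true
adj (doubleStar L) centreˡ  (leaf j) = lookup L j
adj (doubleStar L) centreʳ  centreˡ  = true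
adj (doubleStar L) centreʳ  centreʳ  = false
adj (doubleStar L) centreʳ  (leaf j) = not (lookup L j)
adj (doubleStar L) (leaf i) centreˡ  = lookup L i
adj (doubleStar L) (leaf i) centreʳ  = not (lookup L i)
adj (doubleStar L) (leaf i) (leaf j) = false
symm (doubleStar L) centreˡ  centreˡ  = refl
symm (doubleStar L) centreˡ  centreʳ  = refl
symm (doubleStar L) centreˡ  (leaf j) = refl
symm (doubleStar L) centreʳ  centreˡ  = refl
symm (doubleStar L) centreʳ  centreʳ  = refl
symm (doubleStar L) centreʳ  (leaf j) = refl
symm (doubleStar L) (leaf i) centreˡ  = refl
symm (doubleStar L) (leaf i) centreʳ  = refl
symm (doubleStar L) (leaf i) (leaf j) = refl
irrefl (doubleStar L) centreˡ  = refl
irrefl (doubleStar L) centreʳ  = refl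
irrefl (doubleStar L) (leaf i) = refl

module _ (L : Subset m) where

  private
    S : Graph (2 + m)
    S = doubleStar L

  degree-centreˡ : ∣ N S centreˡ ∣ ≡ suc ∣ L ∣
  degree-centreˡ = cong (suc ∘ ∣_∣) (tabulate∘lookup L)

  degree-centreʳ : ∣ N S centreʳ ∣ ≡ suc ∣ ∁ L ∣
  degree-centreʳ = cong (suc ∘ ∣_∣)
    (trans (tabulate-∘ not (lookup L)) (cong (map not) (tabulate∘lookup L)))

  N-leaf : ∀ i → N S (leaf i) ≡ lookup L i ∷ not (lookup L i) ∷ ⊥
  N-leaf i = cong (λ p → lookup L i ∷ not (lookup L i) ∷ p)
    (trans (tabulate-cong (λ j → sym (lookup-replicate j false))) (tabulate∘lookup ⊥))

  degree-leaf : ∀ i → ∣ N S (leaf i) ∣ ≡ 1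
  degree-leaf i = trans (cong ∣_∣ (N-leaf i)) (∣b∷¬b∷⊥∣≡1 (lookup L i))
    where
    ∣b∷¬b∷⊥∣≡1 : ∀ b → ∣ b ∷ not b ∷ ⊥ {m} ∣ ≡ 1
    ∣b∷¬b∷⊥∣≡1 true  = cong suc (∣⊥∣≡0 m)
    ∣b∷¬b∷⊥∣≡1 false = cong suc (∣⊥∣≡0 m)

  doubleStar-dominated : ∀ x → x ∈ N S centreˡ ⊎ x ∈ N S centreʳ
  doubleStar-dominated centreˡ  = inj₂ (adj⇒∈N S centreʳ refl)
  doubleStar-dominated centreʳ  = inj₁ (adj⇒∈N S centreˡ refl)
  doubleStar-dominated (leaf j) with lookup L j in eq
  ... | true  = inj₁ (adj⇒∈N S centreˡ eq)
  ... | false = inj₂ (adj⇒∈N S centreʳ (cong not eq))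

  module _ (∣L∣≤d : ∣ L ∣ ≤ d) (∣∁L∣≤d : ∣ ∁ L ∣ ≤ d) where

    doubleStar-maxDegree : MaxDegree≤ S (suc d)
    doubleStar-maxDegree centreˡ  = ≤-trans (≤-reflexive degree-centreˡ) (s≤s ∣L∣≤d)
    doubleStar-maxDegree centreʳ  = ≤-trans (≤-reflexive degree-centreʳ) (s≤s ∣∁L∣≤d)
    doubleStar-maxDegree (leaf i) = ≤-trans (≤-reflexive (degree-leaf i)) (s≤s z≤n)

    doubleStar-deleteEdge-maxDegree : 1 ≤ d → MaxDegree≤ (deleteEdge S centreˡ centreʳ) d
    doubleStar-deleteEdge-maxDegree _ centreˡ =
      s≤s⁻¹ (<-≤-trans (degree-deleteEdge-<ˡ S centreˡ centreʳ refl) (doubleStar-maxDegree centreˡ))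
    doubleStar-deleteEdge-maxDegree _ centreʳ =
      s≤s⁻¹ (<-≤-trans (degree-deleteEdge-<ʳ S centreˡ centreʳ refl) (doubleStar-maxDegree centreʳ))
    doubleStar-deleteEdge-maxDegree 1≤d (leaf i) =
      ≤-trans (degree-deleteEdge-≤ S centreˡ centreʳ (leaf i)) (subst (_≤ d) (sym (degree-leaf i)) 1≤d)

∣⊤-centres∣≡ : ∀ m → ∣ ⊤ {2 + m} - centreˡ - centreʳ ∣ ≡ m
∣⊤-centres∣≡ m = trans (cong ∣_∣ (trans (cong (_─ ⊥) (p─⊥≡p (⊤ {m}))) (p─⊥≡p ⊤))) (∣⊤∣≡n m)

IsLkt-doubleStar : ∀ (L : Subset (k + k)) → 1 ≤ k → ∣ L ∣ ≤ k → ∣ ∁ L ∣ ≤ k →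
                   IsLkt (doubleStar L) k (k + k)
IsLkt-doubleStar {k = k} L 1≤k ∣L∣≤k ∣∁L∣≤k =
  (⊤ - centreˡ - centreʳ , leaves-packing , ∣⊤-centres∣≡ (k + k))
  , λ B → dominatingPair⇒∣B∣≤k+k S centreˡ centreʳ B (doubleStar-dominated L)
  where
  S : Graph (2 + (k + k))
  S = doubleStar L
  leaves-packing : IsTotalLimitedPacking S k (⊤ - centreˡ - centreʳ)
  leaves-packing = packing-deleteEdge⁻ S centreˡ centreʳ ⊤
    (⊤-packing (deleteEdge S centreˡ centreʳ) (doubleStar-deleteEdge-maxDegree L ∣L∣≤k ∣∁L∣≤k 1≤k))

mainTheorem6 : (k : ℕ) → 1 ≤ k →
    ((∀ {n} (G : Graph n) (u v : Fin n) → adj G u v ≡ true →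
       ∀ m m′ → IsLkt G k m → IsLkt (deleteEdge G u v) k m′ →
       m ≤ m′ × m′ ≤ m + 2)
    × Σ ℕ (λ n → Σ (Graph n) (λ G → Σ (Fin n) (λ u → Σ (Fin n) (λ v →
        adj G u v ≡ true × Σ ℕ (λ m → Σ ℕ (λ m′ →
          IsLkt G k m × IsLkt (deleteEdge G u v) k m′ × m′ ≡ m))))))
    × Σ ℕ (λ n → Σ (Graph n) (λ G → Σ (Fin n) (λ u → Σ (Fin n) (λ v →
        adj G u v ≡ true × Σ ℕ (λ m → Σ ℕ (λ m′ →
          IsLkt G k m × IsLkt (deleteEdge G u v) k m′ × m′ ≡ m + 2)))))))
mainTheorem6 k 1≤k =
  -- the bounds hold for every pair u, v: if uv is not an edge, deleteEdge changes nothing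
  (λ G u v _ _ _ → IsLkt-deleteEdge-bounds G u v)
  , (2 , K₂ , centreˡ , centreʳ , refl , 2 , 2
    , IsLkt-⊤ K₂ maxDegree-K₂
    , IsLkt-⊤ (deleteEdge K₂ centreˡ centreʳ) (MaxDegree≤-deleteEdge K₂ centreˡ centreʳ maxDegree-K₂)
    , refl)
  , (2 + (k + k) , S , centreˡ , centreʳ , refl , k + k , 2 + (k + k)
    , IsLkt-doubleStar L 1≤k ∣L∣≤k ∣∁L∣≤k
    , IsLkt-⊤ (deleteEdge S centreˡ centreʳ) (doubleStar-deleteEdge-maxDegree L ∣L∣≤k ∣∁L∣≤k 1≤k)
    , +-comm 2 (k + k))
  where
  K₂ : Graph 2
  K₂ = doubleStar []
  maxDegree-K₂ : MaxDegree≤ K₂ k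
  maxDegree-K₂ w = ≤-trans (doubleStar-maxDegree [] z≤n z≤n w) 1≤k
  L : Subset (k + k)
  L = prefix k
  ∣L∣≤k : ∣ L ∣ ≤ k
  ∣L∣≤k = ≤-reflexive (∣prefix∣≡ k k)
  ∣∁L∣≤k : ∣ ∁ L ∣ ≤ k
  ∣∁L∣≤k = ≤-reflexive (∣∁prefix∣≡ k k)
  S : Graph (2 + (k + k))
  S = doubleStar L
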